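{- Let $\Pi\subseteq\mathfrak S_n$ form an allowable graph of permutations. Then $\mathcal T_\Pi=\{X^\sigma:\sigma\in\Pi\}\subseteq\{+,-,0\}^{\binom{[n]}{2}}$ is the set of topes of an acycloid.
   Context: Permutations $\sigma\in\mathfrak S_n$ are viewed as words $[\sigma(1),\dots,\sigma(n)]$; a substring is a contiguous subword. A move is a set of one or more pairwise disjoint substrings (of length at least $2$); it is applied to $\sigma$ by reversing each of these substrings, giving a permutation $\gamma$. Its inversion set $\mathrm{Inv}_m$ is the set of pairs $(i,j)$, $i<j$, of letters lying in a common substring of $m$ (equivalently $\mathrm{inv}(\sigma)\triangle\mathrm{inv}(\gamma)$, where $\mathrm{inv}(\sigma)$ is the set of pairs of letters $i<j$ with $j$ before $i$ in $\sigma$). An allowable sequence in $\Pi$ from $\sigma$ to $\sigma'$ is a sequence $\sigma=\sigma_0,\dots,\sigma_l=\sigma'$ of elements of $\Pi$ where each $\sigma_k$ is obtained from $\sigma_{k-1}$ by a move $m_k$, and each pair of letters is reversed at most once (the sets $\mathrm{Inv}_{m_k}$ are pairwise disjoint). The reverse $\bar\sigma$ is given by $\bar\sigma(t)=\sigma(n-t+1)$. A set $\Pi\subseteq\mathfrak S_n$ forms an allowable graph of permutations if there is a set $\mathcal M$ of moves with: (P1) $\sigma\in\Pi\Rightarrow\bar\sigma\in\Pi$; (P2) any $\sigma,\sigma'\in\Pi$ are joined by an allowable sequence in $\Pi$ whose moves lie in $\mathcal M$; (P3) for $m,s\in\mathcal M$, either $\mathrm{Inv}_m=\mathrm{Inv}_s$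 or $\mathrm{Inv}_m\cap\mathrm{Inv}_s=\emptyset$. $\binom{[n]}{2}$ is the set of pairs $(i,j)$, $i<j$; $X^\sigma_{(i,j)}=+$ if $i$ appears before $j$ in $\sigma$ and $-$ otherwise. For sign vectors: $S(X,Y)=\{e:\{X_e,Y_e\}=\{+,-\}\}$; the support is $\{e: X_e\ne0\}$; for a set $\mathcal T$ of sign vectors, the parallelism class $[e]$ of $e$ is the set of $f$ with $X_f=X_e$ for all $X\in\mathcal T$ or $X_f=-X_e$ for all $X\in\mathcal T$; ${}_{ -F}X$ negates the entries of $X$ in $F$. A set $\mathcal T\subseteq\{+,-,0\}^E$ is the set of topes of an acycloid if: (T1) all elements of $\mathcal T$ have the same support; (T2) $X\in\mathcal T\Rightarrow -X\in\mathcal T$; (T3) if $X\ne Y\in\mathcal T$ there is $f\in S(X,Y)$ with ${}_{ -[f]}X\in\mathcal T$. -}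

module Defs where

open import Data.Nat using (ℕ; _≤_)
open import Data.Fin using (Fin; _<_; _≟_)
open import Data.Bool using (Bool; true; false; if_then_else_)
open import Data.List using (List; []; _∷_; _++_; reverse; length; allFin; concat)
open import Data.List.Membership.Propositional using (_∈_)
open import Data.List.Relation.Unary.All using (All)
open import Data.List.Relation.Unary.AllPairs using (AllPairs)
open import Data.List.Relation.Unary.Unique.Propositional using (Unique)
open import Data.List.Relation.Binary.Permutation.Propositional using (_↭_)
open import Data.Product using (Σ; ∃; _×_; _,_; proj₁; proj₂)
open import Data.Sum using (_⊎_)
open import Data.Empty using (⊥)
open import Relation.Nullary using (¬_; does)
open import Relation.Binary.PropositionalEquality using (_≡_)

data Sign : Set where
  plus minus zero : Sign

neg : Sign → Sign
neg plus  = minus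
neg minus = plus
neg zero  = zero

SignVec : Set → Set
SignVec E = E → Sign

SignVecSet : Set → Set₁
SignVecSet E = SignVec E → Set

Sep : {E : Set} → SignVec E → SignVec E → E → Set
Sep X Y e = (X e ≡ plus × Y e ≡ minus) ⊎ (X e ≡ minus × Y e ≡ plus)

Supp : {E : Set} → SignVec E → E → Set
Supp X e = ¬ (X e ≡ zero)

ParClass : {E : Set} → SignVecSet E → E → E → Set
ParClass 𝒯 e f = (∀ X → 𝒯 X → X f ≡ X e) ⊎ (∀ X → 𝒯 X → X f ≡ neg (X e))

IsNegOn : {E : Set} → (E → Set) → SignVec E → SignVec E → Set
IsNegOn F X Y = ∀ g → (F g → Y g ≡ neg (X g)) × (¬ F g → Y g ≡ X g)

record IsAcycloidTopes {E : Set} (𝒯 : SignVecSet E) : Set where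
  field
    T1 : ∀ X Y → 𝒯 X → 𝒯 Y → ∀ e → (Supp X e → Supp Y e) × (Supp Y e → Supp X e)
    T2 : ∀ X → 𝒯 X → 𝒯 (λ e → neg (X e))
    T3 : ∀ X Y → 𝒯 X → 𝒯 Y → ¬ (∀ e → X e ≡ Y e) →
         Σ E λ f → Sep X Y f × Σ (SignVec E) λ Z → 𝒯 Z × IsNegOn (ParClass 𝒯 f) X Z

Word : ℕ → Set
Word n = List (Fin n)

IsPerm : {n : ℕ} → Word n → Set
IsPerm {n} σ = σ ↭ allFin n

Pair : ℕ → Set
Pair n = Σ (Fin n × Fin n) λ p → proj₁ p < proj₂ p

before : {n : ℕ} → Fin n → Fin n → Word n → Bool
before i j [] = false
before i j (x ∷ xs) =
  if does (x ≟ i) then true else (if does (x ≟ j) then false else before i j xs)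

signVecOf : {n : ℕ} → Word n → SignVec (Pair n)
signVecOf σ ((i , j) , _) = if before i j σ then plus else minus

TopesOf : {n : ℕ} → (Word n → Set) → SignVecSet (Pair n)
TopesOf Π X = Σ (Word _) λ σ → Π σ × (∀ e → X e ≡ signVecOf σ e)

-- Moves: a move is a (finite) set of pairwise disjoint substrings,
-- each given as a word of letters.

Move : ℕ → Set
Move n = List (Word n)

IsMove : {n : ℕ} → Move n → Set
IsMove m = ¬ (m ≡ []) × All (λ s → 2 ≤ length s) m × Unique (concat m)

-- ApplyInOrder m σ γ : the substrings of m occur in σ, disjointly and
-- in the listed left-to-right order, and γ is σ with each reversed.
data ApplyInOrder {n : ℕ} : Move n → Word n → Word n → Set where
  done : ∀ w → ApplyInOrder [] w w
  skip : ∀ {m x σ γ} → ApplyInOrder m σ γ → ApplyInOrder m (x ∷ σ) (x ∷ γ)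
  flip : ∀ {m s σ γ} → 2 ≤ length s → ApplyInOrder m σ γ →
         ApplyInOrder (s ∷ m) (s ++ σ) (reverse s ++ γ)

-- applying the move m (a set of substrings: order irrelevant) to σ gives γ
Applies : {n : ℕ} → Move n → Word n → Word n → Set
Applies m σ γ = Σ (Move _) λ m' → m' ↭ m × ApplyInOrder m' σ γ

Inv : {n : ℕ} → Move n → Pair n → Set
Inv m ((i , j) , _) = Σ (Word _) λ s → s ∈ m × i ∈ s × j ∈ s

DisjointInv : {n : ℕ} → Move n → Move n → Set
DisjointInv m s = ∀ e → Inv m e → Inv s e → ⊥

data SeqIn {n : ℕ} (Π : Word n → Set) (M : Move n → Set) :
       Word n → Word n → List (Move n) → Set where
  [] : ∀ {σ} → Π σ → SeqIn Π M σ σ []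
  _∷_ : ∀ {σ τ σ' m ms} → (Π σ × M m × Applies m σ τ) →
        SeqIn Π M τ σ' ms → SeqIn Π M σ σ' (m ∷ ms)

AllowableSeq : {n : ℕ} → (Word n → Set) → (Move n → Set) → Word n → Word n → Set
AllowableSeq Π M σ σ' =
  Σ (List (Move _)) λ ms → SeqIn Π M σ σ' ms × AllPairs DisjointInv ms

record IsAllowableGraph {n : ℕ} (Π : Word n → Set) : Set₁ where
  field
    M     : Move n → Set
    M-ok  : ∀ m → M m → IsMove m
    P1    : ∀ σ → Π σ → Π (reverse σ)
    P2    : ∀ σ σ' → Π σ → Π σ' → AllowableSeq Π M σ σ'
    P3    : ∀ m s → M m → M s →
            (∀ e → (Inv m e → Inv s e) × (Inv s e → Inv m e)) ⊎ DisjointInv m s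

-- A move reverses exactly the pairs in its inversion set and leaves every other pair in
-- place, so X^γ is X^σ negated on Inv_m. Given X^σ ≠ X^σ', take an allowable sequence from
-- σ to σ' and a pair f reversed by its first move m. Since no pair is reversed twice, f
-- separates X^σ and X^σ'. By (P3) every move of ℳ reverses either all of Inv_m or none of
-- it, so along any allowable sequence the pairs of Inv_m keep their relative signs: Inv_m
-- lies in the parallelism class [f]. Hence the tope after the first move is X^σ negated
-- exactly on [f], which is (T3); (T1) holds as X^σ has full support and (T2) by (P1).
module Submission where

open import Defs
open import Data.Nat using (ℕ; s≤s)
open import Data.Fin using (Fin; _<_; _≟_)
open import Data.Fin.Properties using (<⇒≢; <-cmp)
open import Data.Bool using (Bool; true; false; not; if_then_else_)
open import Data.List using (List; []; _∷_; _++_; reverse)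
open import Data.List.Properties using (unfold-reverse)
open import Data.List.Membership.Propositional using (_∈_; _∉_; find; lose)
open import Data.List.Membership.Propositional.Properties using (∈-++⁺ˡ; ∈-++⁺ʳ; ∈-allFin)
open import Data.List.Relation.Unary.Any using (here; there; any?)
open import Data.List.Relation.Unary.Any.Properties using (reverse⁺; reverse⁻)
open import Data.List.Relation.Unary.All using (All; []; _∷_)
open import Data.List.Relation.Unary.All.Properties using (All¬⇒¬Any; ++⁻ˡ)
open import Data.List.Relation.Unary.Unique.Propositional using (Unique; []; _∷_)
open import Data.List.Relation.Unary.Unique.Propositional.Properties using (allFin⁺)
open import Data.List.Relation.Binary.Permutation.Propositional using (_↭_; ↭-sym; ↭⇒↭ₛ)
open import Data.List.Relation.Binary.Permutation.Propositional.Properties using (∈-resp-↭)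
import Data.List.Relation.Binary.Permutation.Setoid.Properties as PermutationSetoid
open import Data.Product using (Σ; _×_; _,_; proj₁; proj₂)
open import Data.Sum using (_⊎_; inj₁; inj₂)
open import Data.Empty using (⊥-elim)
open import Function using (id)
open import Relation.Binary.Definitions using (tri<; tri≈; tri>)
open import Relation.Binary.PropositionalEquality
  using (_≡_; _≢_; refl; sym; trans; cong; setoid; module ≡-Reasoning)
open import Relation.Nullary using (¬_; Dec; yes; no)
open import Relation.Nullary.Decidable using (map′; _×-dec_)

opposite⇒Sep : ∀ {E} (X Y : SignVec E) f → Supp X f → Y f ≡ neg (X f) → Sep X Y f
opposite⇒Sep X Y f X≢0 Y≡-X with X f
... | plus  = inj₁ (refl , Y≡-X)
... | minus = inj₂ (refl , Y≡-X)
... | zero  = ⊥-elim (X≢0 refl)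

ParClass-neg : ∀ {E} {𝒯 : SignVecSet E} {X Z f g} → 𝒯 X → 𝒯 Z →
               Z f ≡ neg (X f) → ParClass 𝒯 f g → Z g ≡ neg (X g)
ParClass-neg {X = X} {Z} {f} {g} 𝒯X 𝒯Z Zf≡-Xf (inj₁ same) = begin
  Z g             ≡⟨ same Z 𝒯Z ⟩
  Z f             ≡⟨ Zf≡-Xf ⟩
  neg (X f)       ≡⟨ cong neg (sym (same X 𝒯X)) ⟩
  neg (X g)       ∎
  where open ≡-Reasoning
ParClass-neg {X = X} {Z} {f} {g} 𝒯X 𝒯Z Zf≡-Xf (inj₂ opposite) = begin
  Z g             ≡⟨ opposite Z 𝒯Z ⟩
  neg (Z f)       ≡⟨ cong neg Zf≡-Xf ⟩
  neg (neg (X f)) ≡⟨ cong neg (sym (opposite X 𝒯X)) ⟩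
  neg (X g)       ∎
  where open ≡-Reasoning

signOf : Bool → Sign
signOf b = if b then plus else minus

signOf-not : ∀ b → signOf (not b) ≡ neg (signOf b)
signOf-not true  = refl
signOf-not false = refl

signOf-nonzero : ∀ b → signOf b ≢ zero
signOf-nonzero true  ()
signOf-nonzero false ()

signOf-related : ∀ b c → signOf c ≡ signOf b ⊎ signOf c ≡ neg (signOf b)
signOf-related true  true  = inj₁ refl
signOf-related true  false = inj₂ refl
signOf-related false true  = inj₂ refl
signOf-related false false = inj₁ refl

module _ {A : Set} where

  Unique-resp-↭ : {xs ys : List A} → xs ↭ ys → Unique xs → Unique ys
  Unique-resp-↭ p = PermutationSetoid.Unique-resp-↭ (setoid A) (↭⇒↭ₛ p)

  Unique-++⁻ˡ : ∀ (xs : List A) {ys} → Unique (xs ++ ys) → Unique xs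
  Unique-++⁻ˡ []       _        = []
  Unique-++⁻ˡ (x ∷ xs) (x∉ ∷ u) = ++⁻ˡ xs x∉ ∷ Unique-++⁻ˡ xs u

  Unique-++⁻ʳ : ∀ (xs : List A) {ys} → Unique (xs ++ ys) → Unique ys
  Unique-++⁻ʳ []       u       = u
  Unique-++⁻ʳ (x ∷ xs) (_ ∷ u) = Unique-++⁻ʳ xs u

  Unique-++-disjoint : ∀ (xs : List A) {ys a} → Unique (xs ++ ys) → a ∈ xs → a ∉ ys
  Unique-++-disjoint (x ∷ xs) (x∉ ∷ _) (here refl) a∈ys = All¬⇒¬Any x∉ (∈-++⁺ʳ xs a∈ys)
  Unique-++-disjoint (x ∷ xs) (_ ∷ u)  (there a∈xs) = Unique-++-disjoint xs u a∈xs

  ∈-tail : ∀ {a x : A} {w} → x ≢ a → a ∈ x ∷ w → a ∈ w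
  ∈-tail x≢a (here a≡x)  = ⊥-elim (x≢a (sym a≡x))
  ∈-tail _   (there a∈w) = a∈w

module _ {n : ℕ} where
  open import Data.List.Membership.DecPropositional (_≟_ {n}) using (_∈?_)

  before-∈-∉ : ∀ {i j : Fin n} xs {ys} → i ∈ xs → j ∉ xs → before i j (xs ++ ys) ≡ true
  before-∈-∉ {i} {j} (x ∷ xs) i∈ j∉ with x ≟ i
  ... | yes _ = refl
  ... | no x≢i with x ≟ j
  ... | yes x≡j = ⊥-elim (j∉ (here (sym x≡j)))
  ... | no _    = before-∈-∉ xs (∈-tail x≢i i∈) (λ j∈ → j∉ (there j∈))

  before-∉-∈ : ∀ {i j : Fin n} xs {ys} → i ∉ xs → j ∈ xs → before i j (xs ++ ys) ≡ false
  before-∉-∈ {i} {j} (x ∷ xs) i∉ j∈ with x ≟ i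
  ... | yes x≡i = ⊥-elim (i∉ (here (sym x≡i)))
  ... | no _ with x ≟ j
  ... | yes _    = refl
  ... | no x≢j   = before-∉-∈ xs (λ i∈ → i∉ (there i∈)) (∈-tail x≢j j∈)

  before-++ˡ : ∀ {i j : Fin n} xs {ys} → i ∈ xs ⊎ j ∈ xs →
               before i j (xs ++ ys) ≡ before i j xs
  before-++ˡ [] (inj₁ ())
  before-++ˡ [] (inj₂ ())
  before-++ˡ {i} {j} (x ∷ xs) i∈⊎j∈ with x ≟ i
  ... | yes _ = refl
  ... | no x≢i with x ≟ j
  ... | yes _ = refl
  ... | no x≢j with i∈⊎j∈
  ... | inj₁ i∈ = before-++ˡ xs (inj₁ (∈-tail x≢i i∈))
  ... | inj₂ j∈ = before-++ˡ xs (inj₂ (∈-tail x≢j j∈))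

  before-++ʳ : ∀ {i j : Fin n} xs {ys} → i ∉ xs → j ∉ xs →
               before i j (xs ++ ys) ≡ before i j ys
  before-++ʳ []                 _  _  = refl
  before-++ʳ {i} {j} (x ∷ xs) i∉ j∉ with x ≟ i
  ... | yes x≡i = ⊥-elim (i∉ (here (sym x≡i)))
  ... | no _ with x ≟ j
  ... | yes x≡j = ⊥-elim (j∉ (here (sym x≡j)))
  ... | no _    = before-++ʳ xs (λ i∈ → i∉ (there i∈)) (λ j∈ → j∉ (there j∈))

  before-swap : ∀ {i j : Fin n} w → i ≢ j → i ∈ w ⊎ j ∈ w →
                before j i w ≡ not (before i j w)
  before-swap [] _ (inj₁ ())
  before-swap [] _ (inj₂ ())
  before-swap {i} {j} (x ∷ w) i≢j i∈⊎j∈ with x ≟ i | x ≟ j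
  ... | yes refl | yes refl = ⊥-elim (i≢j refl)
  ... | yes refl | no _     = refl
  ... | no _     | yes refl = refl
  ... | no x≢i   | no x≢j with i∈⊎j∈
  ... | inj₁ i∈ = before-swap w i≢j (inj₁ (∈-tail x≢i i∈))
  ... | inj₂ j∈ = before-swap w i≢j (inj₂ (∈-tail x≢j j∈))

  before-reverse-swap : ∀ {i j : Fin n} w → Unique w → i ∈ w → j ∈ w → i ≢ j →
                        before i j (reverse w) ≡ before j i w
  before-reverse-swap {i} {j} (x ∷ w) (x∉ ∷ u) i∈ j∈ i≢j
    rewrite unfold-reverse x w with x ≟ j | x ≟ i
  ... | yes refl | yes refl = ⊥-elim (i≢j refl)
  ... | yes refl | no x≢i   =
        before-∈-∉ (reverse w) (reverse⁺ (∈-tail x≢i i∈)) (λ x∈ → All¬⇒¬Any x∉ (reverse⁻ x∈))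
  ... | no x≢j   | yes refl =
        before-∉-∈ (reverse w) (λ x∈ → All¬⇒¬Any x∉ (reverse⁻ x∈)) (reverse⁺ (∈-tail x≢j j∈))
  ... | no x≢j   | no x≢i   = trans
        (before-++ˡ (reverse w) (inj₁ (reverse⁺ (∈-tail x≢i i∈))))
        (before-reverse-swap w u (∈-tail x≢i i∈) (∈-tail x≢j j∈) i≢j)

  before-reverse : ∀ {i j : Fin n} w → Unique w → i ∈ w → j ∈ w → i ≢ j →
                   before i j (reverse w) ≡ not (before i j w)
  before-reverse w u i∈ j∈ i≢j =
    trans (before-reverse-swap w u i∈ j∈ i≢j) (before-swap w i≢j (inj₁ i∈))

  InCommonSubstring : Move n → Fin n → Fin n → Set
  InCommonSubstring m i j = Σ (Word n) λ s → s ∈ m × i ∈ s × j ∈ s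

  Inv-resp-↭ : ∀ {m m' : Move n} → m ↭ m' → ∀ e → Inv m e → Inv m' e
  Inv-resp-↭ p _ (s , s∈m , i∈s , j∈s) = s , ∈-resp-↭ p s∈m , i∈s , j∈s

  Inv? : ∀ (m : Move n) e → Dec (Inv m e)
  Inv? m ((i , j) , _) =
    map′ find (λ (s , s∈m , i∈j∈) → lose s∈m i∈j∈)
         (any? (λ s → (i ∈? s) ×-dec (j ∈? s)) m)

  Inv-nonempty : ∀ (m : Move n) → IsMove m → Σ (Pair n) (Inv m)
  Inv-nonempty [] ([]≢[] , _) = ⊥-elim ([]≢[] refl)
  Inv-nonempty ([] ∷ _) (_ , () ∷ _ , _)
  Inv-nonempty ((_ ∷ []) ∷ _) (_ , s≤s () ∷ _ , _)
  Inv-nonempty ((a ∷ b ∷ s) ∷ m) (_ , _ , (a≢b ∷ _) ∷ _) with <-cmp a b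
  ... | tri< a<b _ _ = ((a , b) , a<b) , (a ∷ b ∷ s) , here refl , here refl , there (here refl)
  ... | tri≈ _ a≡b _ = ⊥-elim (a≢b a≡b)
  ... | tri> _ _ b<a = ((b , a) , b<a) , (a ∷ b ∷ s) , here refl , there (here refl) , here refl

  apply-⊆ : ∀ {m : Move n} {σ γ} → ApplyInOrder m σ γ → ∀ {s a} → s ∈ m → a ∈ s → a ∈ σ
  apply-⊆ (skip ap)           s∈m         a∈s = there (apply-⊆ ap s∈m a∈s)
  apply-⊆ (flip _ ap)         (here refl) a∈s = ∈-++⁺ˡ a∈s
  apply-⊆ (flip {s = s} _ ap) (there s∈m) a∈s = ∈-++⁺ʳ s (apply-⊆ ap s∈m a∈s)

  apply-reverses : ∀ {m : Move n} {σ γ i j} → ApplyInOrder m σ γ → Unique σ → i ≢ j →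
                   InCommonSubstring m i j → before i j γ ≡ not (before i j σ)
  apply-reverses {i = i} {j} (skip {x = x} ap) (x∉ ∷ u) i≢j inv@(s , s∈m , i∈s , j∈s)
    with x ≟ i
  ... | yes refl = ⊥-elim (All¬⇒¬Any x∉ (apply-⊆ ap s∈m i∈s))
  ... | no _ with x ≟ j
  ... | yes refl = ⊥-elim (All¬⇒¬Any x∉ (apply-⊆ ap s∈m j∈s))
  ... | no _     = apply-reverses ap u i≢j inv
  apply-reverses (flip {s = s} {σ} {γ} _ ap) u i≢j (_ , here refl , i∈s , j∈s) = begin
    before _ _ (reverse s ++ γ) ≡⟨ before-++ˡ (reverse s) (inj₁ (reverse⁺ i∈s)) ⟩
    before _ _ (reverse s)      ≡⟨ before-reverse s (Unique-++⁻ˡ s u) i∈s j∈s i≢j ⟩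
    not (before _ _ s)          ≡⟨ cong not (sym (before-++ˡ s (inj₁ i∈s))) ⟩
    not (before _ _ (s ++ σ))   ∎
    where open ≡-Reasoning
  apply-reverses {i = i} {j} (flip {s = s} {σ} {γ} _ ap) u i≢j (s' , there s'∈m , i∈s' , j∈s')
    = begin
    before i j (reverse s ++ γ) ≡⟨ before-++ʳ (reverse s) (λ p → i∉s (reverse⁻ p))
                                                            (λ p → j∉s (reverse⁻ p)) ⟩
    before i j γ                ≡⟨ apply-reverses ap (Unique-++⁻ʳ s u) i≢j
                                     (s' , s'∈m , i∈s' , j∈s') ⟩
    not (before i j σ)          ≡⟨ cong not (sym (before-++ʳ s i∉s j∉s)) ⟩
    not (before i j (s ++ σ))   ∎
    where
      open ≡-Reasoning
      i∉s : i ∉ s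
      i∉s i∈s = Unique-++-disjoint s u i∈s (apply-⊆ ap s'∈m i∈s')
      j∉s : j ∉ s
      j∉s j∈s = Unique-++-disjoint s u j∈s (apply-⊆ ap s'∈m j∈s')

  apply-preserves : ∀ {m : Move n} {σ γ i j} → ApplyInOrder m σ γ → Unique σ →
                    ¬ InCommonSubstring m i j → before i j γ ≡ before i j σ
  apply-preserves (done _) _ _ = refl
  apply-preserves {i = i} {j} (skip {x = x} ap) (_ ∷ u) ¬inv with x ≟ i
  ... | yes _ = refl
  ... | no _ with x ≟ j
  ... | yes _ = refl
  ... | no _  = apply-preserves ap u ¬inv
  apply-preserves {i = i} {j} (flip {s = s} {σ} {γ} _ ap) u ¬inv with i ∈? s | j ∈? s
  ... | yes i∈s | yes j∈s = ⊥-elim (¬inv (s , here refl , i∈s , j∈s))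
  ... | yes i∈s | no j∉s  = trans
        (before-∈-∉ (reverse s) (reverse⁺ i∈s) (λ p → j∉s (reverse⁻ p)))
        (sym (before-∈-∉ s i∈s j∉s))
  ... | no i∉s  | yes j∈s = trans
        (before-∉-∈ (reverse s) (λ p → i∉s (reverse⁻ p)) (reverse⁺ j∈s))
        (sym (before-∉-∈ s i∉s j∈s))
  ... | no i∉s  | no j∉s  = begin
    before i j (reverse s ++ γ) ≡⟨ before-++ʳ (reverse s) (λ p → i∉s (reverse⁻ p))
                                                            (λ p → j∉s (reverse⁻ p)) ⟩
    before i j γ                ≡⟨ apply-preserves ap (Unique-++⁻ʳ s u)
                                     (λ (s' , s'∈m , p) → ¬inv (s' , there s'∈m , p)) ⟩
    before i j σ                ≡⟨ sym (before-++ʳ s i∉s j∉s) ⟩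
    before i j (s ++ σ)         ∎
    where open ≡-Reasoning

  signVecOf-nonzero : ∀ (σ : Word n) e → Supp (signVecOf σ) e
  signVecOf-nonzero σ ((i , j) , _) = signOf-nonzero (before i j σ)

  TopesOf-nonzero : ∀ {Π : Word n → Set} {X} → TopesOf Π X → ∀ e → Supp X e
  TopesOf-nonzero (σ , _ , X≡) e Xe≡0 = signVecOf-nonzero σ e (trans (sym (X≡ e)) Xe≡0)

  signVecOf-related : ∀ (σ : Word n) f g →
                      signVecOf σ g ≡ signVecOf σ f ⊎ signVecOf σ g ≡ neg (signVecOf σ f)
  signVecOf-related σ ((i , j) , _) ((k , l) , _) = signOf-related (before i j σ) (before k l σ)

  signVecOf-reverse : ∀ {σ : Word n} → Unique σ → (∀ a → a ∈ σ) → ∀ e →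
                      signVecOf (reverse σ) e ≡ neg (signVecOf σ e)
  signVecOf-reverse {σ} u complete ((i , j) , i<j) = trans
    (cong signOf (before-reverse σ u (complete i) (complete j) (<⇒≢ i<j)))
    (signOf-not (before i j σ))

  signVecOf-apply-Inv : ∀ {m : Move n} {σ γ} → Unique σ → Applies m σ γ → ∀ e → Inv m e →
                        signVecOf γ e ≡ neg (signVecOf σ e)
  signVecOf-apply-Inv {σ = σ} u (_ , m'↭m , ap) e@((i , j) , i<j) inv = trans
    (cong signOf (apply-reverses ap u (<⇒≢ i<j) (Inv-resp-↭ (↭-sym m'↭m) e inv)))
    (signOf-not (before i j σ))

  signVecOf-apply-¬Inv : ∀ {m : Move n} {σ γ} → Unique σ → Applies m σ γ → ∀ e → ¬ Inv m e →
                         signVecOf γ e ≡ signVecOf σ e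
  signVecOf-apply-¬Inv u (_ , m'↭m , ap) e@((i , j) , _) ¬inv =
    cong signOf (apply-preserves ap u (λ inv → ¬inv (Inv-resp-↭ m'↭m e inv)))

module AllowableGraph {n : ℕ} (Π : Word n → Set) (Π⊆𝔖 : ∀ σ → Π σ → IsPerm σ)
                      (G : IsAllowableGraph Π) where
  open IsAllowableGraph G

  Π⇒Unique : ∀ {σ} → Π σ → Unique σ
  Π⇒Unique {σ} σ∈Π = Unique-resp-↭ (↭-sym (Π⊆𝔖 σ σ∈Π)) (allFin⁺ n)

  Π⇒complete : ∀ {σ} → Π σ → ∀ a → a ∈ σ
  Π⇒complete {σ} σ∈Π a = ∈-resp-↭ (↭-sym (Π⊆𝔖 σ σ∈Π)) (∈-allFin a)

  SeqIn-head : ∀ {σ σ' ms} → SeqIn Π M σ σ' ms → Π σ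
  SeqIn-head ([] σ∈Π)        = σ∈Π
  SeqIn-head ((σ∈Π , _) ∷ _) = σ∈Π

  SeqIn-preserves : ∀ {m τ σ' ms} → SeqIn Π M τ σ' ms → All (DisjointInv m) ms →
                    ∀ e → Inv m e → signVecOf σ' e ≡ signVecOf τ e
  SeqIn-preserves ([] _)                  []             _ _   = refl
  SeqIn-preserves ((τ∈Π , _ , app) ∷ seq) (disj ∷ disjs) e inv = trans
    (SeqIn-preserves seq disjs e inv)
    (signVecOf-apply-¬Inv (Π⇒Unique τ∈Π) app e (disj e inv))

  SeqIn-keeps-relation : ∀ {m} → M m → ∀ f g → Inv m f → Inv m g →
                         (φ : Sign → Sign) → (∀ a → φ (neg a) ≡ neg (φ a)) →
                         ∀ {ρ ρ' ms} → SeqIn Π M ρ ρ' ms →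
                         signVecOf ρ g ≡ φ (signVecOf ρ f) → signVecOf ρ' g ≡ φ (signVecOf ρ' f)
  SeqIn-keeps-relation _ _ _ _ _ _ _ ([] _) rel = rel
  SeqIn-keeps-relation {m} m∈M f g f∈m g∈m φ φ-neg {ρ} {ms = m' ∷ _}
                       (_∷_ {τ = τ} (ρ∈Π , m'∈M , app) seq) rel =
    SeqIn-keeps-relation m∈M f g f∈m g∈m φ φ-neg seq (step (P3 m m' m∈M m'∈M))
    where
      open ≡-Reasoning
      u = Π⇒Unique ρ∈Π
      f-flips = signVecOf-apply-Inv u app f
      g-flips = signVecOf-apply-Inv u app g
      f-stays = signVecOf-apply-¬Inv u app f
      g-stays = signVecOf-apply-¬Inv u app g
      step : (∀ e → (Inv m e → Inv m' e) × (Inv m' e → Inv m e)) ⊎ DisjointInv m m' →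
             signVecOf τ g ≡ φ (signVecOf τ f)
      step (inj₁ same-Inv) = begin
        signVecOf τ g           ≡⟨ g-flips (proj₁ (same-Inv g) g∈m) ⟩
        neg (signVecOf ρ g)     ≡⟨ cong neg rel ⟩
        neg (φ (signVecOf ρ f)) ≡⟨ sym (φ-neg _) ⟩
        φ (neg (signVecOf ρ f)) ≡⟨ cong φ (sym (f-flips (proj₁ (same-Inv f) f∈m))) ⟩
        φ (signVecOf τ f)       ∎
      step (inj₂ disjoint) = begin
        signVecOf τ g           ≡⟨ g-stays (disjoint g g∈m) ⟩
        signVecOf ρ g           ≡⟨ rel ⟩
        φ (signVecOf ρ f)       ≡⟨ cong φ (sym (f-stays (disjoint f f∈m))) ⟩
        φ (signVecOf τ f)       ∎

  TopesOf-keeps-relation : ∀ {σ} → Π σ → ∀ {m} → M m → ∀ f g → Inv m f → Inv m g →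
                           (φ : Sign → Sign) → (∀ a → φ (neg a) ≡ neg (φ a)) →
                           signVecOf σ g ≡ φ (signVecOf σ f) → ∀ X → TopesOf Π X → X g ≡ φ (X f)
  TopesOf-keeps-relation {σ} σ∈Π m∈M f g f∈m g∈m φ φ-neg rel X (ρ , ρ∈Π , X≡) = begin
    X g               ≡⟨ X≡ g ⟩
    signVecOf ρ g     ≡⟨ SeqIn-keeps-relation m∈M f g f∈m g∈m φ φ-neg
                           (proj₁ (proj₂ (P2 σ ρ σ∈Π ρ∈Π))) rel ⟩
    φ (signVecOf ρ f) ≡⟨ cong φ (sym (X≡ f)) ⟩
    φ (X f)           ∎
    where open ≡-Reasoning

  Inv⊆ParClass : ∀ {σ} → Π σ → ∀ {m} → M m → ∀ f g → Inv m f → Inv m g →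
                 ParClass (TopesOf Π) f g
  Inv⊆ParClass {σ} σ∈Π m∈M f g f∈m g∈m with signVecOf-related σ f g
  ... | inj₁ same     = inj₁ (TopesOf-keeps-relation σ∈Π m∈M f g f∈m g∈m id  (λ _ → refl) same)
  ... | inj₂ opposite =
    inj₂ (TopesOf-keeps-relation σ∈Π m∈M f g f∈m g∈m neg (λ _ → refl) opposite)

  TopesOf-T2 : ∀ X → TopesOf Π X → TopesOf Π (λ e → neg (X e))
  TopesOf-T2 X (σ , σ∈Π , X≡) = reverse σ , P1 σ σ∈Π , λ e →
    trans (cong neg (X≡ e)) (sym (signVecOf-reverse (Π⇒Unique σ∈Π) (Π⇒complete σ∈Π) e))

  TopesOf-T3 : ∀ X Y → TopesOf Π X → TopesOf Π Y → ¬ (∀ e → X e ≡ Y e) →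
               Σ (Pair n) λ f → Sep X Y f × Σ (SignVec (Pair n)) λ Z →
                 TopesOf Π Z × IsNegOn (ParClass (TopesOf Π) f) X Z
  TopesOf-T3 X Y (σ , σ∈Π , X≡) (σ' , σ'∈Π , Y≡) X≢Y with P2 σ σ' σ∈Π σ'∈Π
  ... | [] , [] _ , _ = ⊥-elim (X≢Y (λ e → trans (X≡ e) (sym (Y≡ e))))
  ... | m ∷ _ , _∷_ {τ = τ} (_ , m∈M , app) seq , disjs ∷ _ =
    f , opposite⇒Sep X Y f (TopesOf-nonzero 𝒯X f) Yf≡-Xf , signVecOf τ , 𝒯Z , negated-on-[f]
    where
      𝒯X : TopesOf Π X
      𝒯X = σ , σ∈Π , X≡
      f = proj₁ (Inv-nonempty m (M-ok m m∈M))
      f∈m = proj₂ (Inv-nonempty m (M-ok m m∈M))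
      u = Π⇒Unique σ∈Π
      𝒯Z : TopesOf Π (signVecOf τ)
      𝒯Z = τ , SeqIn-head seq , λ _ → refl
      Zf≡-Xf : signVecOf τ f ≡ neg (X f)
      Zf≡-Xf = trans (signVecOf-apply-Inv u app f f∈m) (cong neg (sym (X≡ f)))
      Yf≡-Xf : Y f ≡ neg (X f)
      Yf≡-Xf = trans (Y≡ f) (trans (SeqIn-preserves seq disjs f f∈m) Zf≡-Xf)
      negated-on-[f] : IsNegOn (ParClass (TopesOf Π) f) X (signVecOf τ)
      negated-on-[f] g = ParClass-neg 𝒯X 𝒯Z Zf≡-Xf , outside
        where
          outside : ¬ ParClass (TopesOf Π) f g → signVecOf τ g ≡ X g
          outside g∉[f] with Inv? m g
          ... | yes g∈m = ⊥-elim (g∉[f] (Inv⊆ParClass σ∈Π m∈M f g f∈m g∈m))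
          ... | no  g∉m = trans (signVecOf-apply-¬Inv u app g g∉m) (sym (X≡ g))

theorem7p13 : (n : ℕ) (Π : Word n → Set) →
              (∀ σ → Π σ → IsPerm σ) →
              IsAllowableGraph Π →
              IsAcycloidTopes (TopesOf Π)
theorem7p13 n Π Π⊆𝔖 G = record
  { T1 = λ X Y 𝒯X 𝒯Y e → (λ _ → TopesOf-nonzero 𝒯Y e) , (λ _ → TopesOf-nonzero 𝒯X e)
  ; T2 = TopesOf-T2
  ; T3 = TopesOf-T3
  }
  where open AllowableGraph Π Π⊆𝔖 G
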